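{- Let $G$ be a finite simple graph on $n\geq 2$ vertices with no isolated vertices. Then \[ \sum_{e\in E(G)} \frac{1}{\mathrm{cl}(e) - 1} \geq \frac{n}{2} \qquad\text{and}\qquad \sum_{e\in E(G)} \frac{1}{\mathrm{cl}(e)} \geq \frac{n-c(G)}{2}, \] where $c(G)$ is the number of connected components of $G$.
   Context: For an edge $e$ of $G$, $\mathrm{cl}(e)$ denotes the order of the largest clique of $G$ containing $e$. -}

module Defs where

open import Data.Nat as ℕ using (ℕ; zero; suc; _∸_)
open import Data.Integer as ℤ using (ℤ; +_)
open import Data.Rational as ℚ using (ℚ; 0ℚ; _/_)
open import Data.Fin using (Fin; _<?_)
open import Data.Fin.Subset using (Subset; _∈_; ∣_∣)
open import Data.List using (List; map; foldr)
open import Data.List using () renaming (allFin to allFinL)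
open import Data.Product using (Σ; ∃; _×_)
open import Data.Empty using (⊥)
open import Relation.Nullary using (¬_; yes; no)
open import Relation.Binary using (Decidable)
open import Relation.Binary.PropositionalEquality using (_≡_; _≢_)
open import Relation.Binary.Construct.Closure.ReflexiveTransitive using (Star)
open import Function.Bundles using (_⇔_)
open import Function.Definitions using (Surjective)

record Graph (n : ℕ) : Set₁ where
  field
    Adj    : Fin n → Fin n → Set
    adj?   : Decidable Adj
    sym    : ∀ {i j} → Adj i j → Adj j i
    irrefl : ∀ {i} → ¬ Adj i i
open Graph public

NoIsolated : ∀ {n} → Graph n → Set
NoIsolated {n} G = (i : Fin n) → ∃ λ j → Adj G i j

IsClique : ∀ {n} → Graph n → Subset n → Set
IsClique {n} G S = (i j : Fin n) → i ∈ S → j ∈ S → i ≢ j → Adj G i j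

IsCl : ∀ {n} → Graph n → Fin n → Fin n → ℕ → Set
IsCl {n} G i j k =
  (Σ (Subset n) λ S → IsClique G S × i ∈ S × j ∈ S × ∣ S ∣ ≡ k)
  × ((S : Subset n) → IsClique G S → i ∈ S → j ∈ S → ∣ S ∣ ℕ.≤ k)

Connected : ∀ {n} → Graph n → Fin n → Fin n → Set
Connected G = Star (Adj G)

-- G has exactly c connected components: there is a surjective labelling of the
-- vertices by Fin c whose fibres are exactly the connected components.
HasComponents : ∀ {n} → Graph n → ℕ → Set
HasComponents {n} G c =
  Σ (Fin n → Fin c) λ f →
    Surjective _≡_ _≡_ f × ((i j : Fin n) → (f i ≡ f j) ⇔ Connected G i j)

sumℚ : List ℚ → ℚ
sumℚ = foldr ℚ._+_ 0ℚ

-- Sum of w over the edge set E(G); each edge {i,j} is counted once (as i < j).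
edgeSum : ∀ {n} (G : Graph n) → ((i j : Fin n) → Adj G i j → ℚ) → ℚ
edgeSum {n} G w = sumℚ (map (λ i → sumℚ (map (term i) (allFinL n))) (allFinL n))
  where
  term : Fin n → Fin n → ℚ
  term i j with i <? j | adj? G i j
  ... | yes _ | yes a = w i j a
  ... | _     | _     = 0ℚ

-- 1/k as a rational (with the harmless convention 1/0 = 0; never used on 0 below,
-- since every edge lies in a clique of order ≥ 2).
inv : ℕ → ℚ
inv zero    = 0ℚ
inv (suc k) = + 1 / suc k

module Submission where

-- Summing over ordered pairs of adjacent vertices counts every edge twice, so it suffices to
-- show n ≤ Σ_x Σ_{y~x} 1/(cl(xy) − 1) and n ≤ c + Σ_x Σ_{y~x} 1/cl(xy).
--
-- First bound: a clique through x has at most deg(x) + 1 vertices, so each of the deg(x)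
-- terms at x is at least 1/deg(x).
--
-- Second bound: give a partition of the vertices the potential
--   Σ_x 1/|class(x)|  +  Σ_{x~y in a common class} 1/cl(xy),
-- whose first sum is the number of classes; the partition into singletons has potential ≥ n.
-- While some edge joins two classes, take such an edge uv with t = cl(uv) largest, a clique
-- S ∋ u, v of order t, and merge all classes meeting S. If y ∈ S shares its class with a(y)
-- vertices of S, the number of classes drops by Σ_{y∈S} 1/a(y) − 1, while the pairs of S in
-- different classes become internal; by the choice of uv each weighs at least 1/t, adding at
-- least Σ_{y∈S} (t − a(y))/t. As (a − 1)(t − a) ≥ 0 gives 1/a ≤ 1/t + (t − a)/t, the potential
-- does not decrease. Once no edge joins two classes, each class contains the components of its
-- vertices, so the potential is at most c + Σ_x Σ_{y~x} 1/cl(xy).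

open import Defs hiding (sym)
open import Data.Nat using (ℕ; _≥_; _∸_)
open import Data.Integer as ℤ using (+_)
open import Data.Rational as ℚ using (_/_)
open import Data.Fin using (Fin)
open import Data.Product using (_×_)

open import Algebra.Bundles using (Ring)
open import Data.Bool using (Bool; true; false; if_then_else_; _∧_; not)
open import Data.Bool.Properties using (∧-zeroʳ)
open import Data.Fin as Fin using (zero; suc; _≟_; _<?_)
open import Data.Fin.Subset using (Subset; _∈_; ∣_∣)
import Data.Fin.Properties as Fin
import Data.Integer.Properties as ℤ
open import Data.List using (map; tabulate; allFin; cartesianProduct)
open import Data.List.Extrema.Nat using (argmax; f[xs]≤f[argmax])
open import Data.List.Membership.Propositional.Properties using (∈-cartesianProduct⁺; ∈-allFin)
import Data.List.Relation.Unary.All as All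
open import Data.Nat as ℕ using (zero; suc; z≤n; s≤s; _<ᵇ_)
open import Data.Nat.Induction using (<-wellFounded)
import Data.Nat.Properties as ℕ
open import Data.Product using (∃₂; _,_; proj₁; proj₂; uncurry)
open import Data.Rational using (ℚ; 0ℚ; 1ℚ; ½; _+_; _*_; _-_; -_; _≤_; toℚᵘ)
import Data.Rational.Properties as ℚ
open import Data.Rational.Solver renaming (module +-*-Solver to ℚ-Solver)
open import Data.Rational.Unnormalised as ℚᵘ using (mkℚᵘ; *≡*; *≤*) renaming (_≃_ to _≃ᵘ_)
import Data.Rational.Unnormalised.Properties as ℚᵘ
open import Data.Sum using (_⊎_; inj₁; inj₂)
open import Data.Vec using ([]; _∷_; lookup)
open import Data.Vec.Properties using ([]=⇒lookup; lookup⇒[]=)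
open import Function using (_∘_; id)
open import Function.Bundles using (Equivalence)
open import Induction.WellFounded using (Acc; acc)
open import Relation.Binary using (tri<; tri≈; tri>)
open import Relation.Binary.Construct.Closure.ReflexiveTransitive using (ε; _◅_)
open import Relation.Binary.PropositionalEquality
open import Relation.Nullary using (¬_; Dec; does; yes; no; contradiction)
open import Relation.Nullary.Decidable using (dec-true; dec-false)

open import Algebra.Properties.Semiring.Sum (Ring.semiring ℚ.+-*-ring)
  using (sum; sum-syntax; sum-cong-≗; sum-replicate-zero; ∑-distrib-+; ∑-comm)

-- Fractions

ι : ℕ → ℚ
ι k = + k / 1

toℚᵘ-/ : ∀ i d → toℚᵘ (i / suc d) ≃ᵘ mkℚᵘ i d
toℚᵘ-/ i d = ℚ.toℚᵘ-fromℚᵘ (mkℚᵘ i d)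

/-≤-cross : ∀ p q a b → p ℕ.* suc b ℕ.≤ q ℕ.* suc a → + p / suc a ≤ + q / suc b
/-≤-cross p q a b pb≤qa = ℚ.toℚᵘ-cancel-≤
  (ℚᵘ.≤-respˡ-≃ (ℚᵘ.≃-sym (toℚᵘ-/ (+ p) a)) (ℚᵘ.≤-respʳ-≃ (ℚᵘ.≃-sym (toℚᵘ-/ (+ q) b))
    (*≤* (subst₂ ℤ._≤_ (ℤ.pos-* p (suc b)) (ℤ.pos-* q (suc a)) (ℤ.+≤+ pb≤qa)))))

/-≡-cross : ∀ p q a b → p ℕ.* suc b ≡ q ℕ.* suc a → + p / suc a ≡ + q / suc b
/-≡-cross p q a b pb≡qa = ℚ.≤-antisym
  (/-≤-cross p q a b (ℕ.≤-reflexive pb≡qa)) (/-≤-cross q p b a (ℕ.≤-reflexive (sym pb≡qa)))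

/1-homo-+ : ∀ i j → (i ℤ.+ j) / 1 ≡ i / 1 + j / 1
/1-homo-+ i j = ℚ.toℚᵘ-injective (begin
  toℚᵘ ((i ℤ.+ j) / 1)             ≈⟨ toℚᵘ-/ (i ℤ.+ j) 0 ⟩
  mkℚᵘ (i ℤ.+ j) 0                 ≈⟨ *≡* (cong (ℤ._* + 1) (cong₂ ℤ._+_ (ℤ.*-identityʳ i) (ℤ.*-identityʳ j))) ⟨
  mkℚᵘ i 0 ℚᵘ.+ mkℚᵘ j 0           ≈⟨ ℚᵘ.+-cong (toℚᵘ-/ i 0) (toℚᵘ-/ j 0) ⟨
  toℚᵘ (i / 1) ℚᵘ.+ toℚᵘ (j / 1)   ≈⟨ ℚ.toℚᵘ-homo-+ (i / 1) (j / 1) ⟨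
  toℚᵘ (i / 1 + j / 1)             ∎)
  where open ℚᵘ.≃-Reasoning

/1-homo-neg : ∀ i → (ℤ.- i) / 1 ≡ - (i / 1)
/1-homo-neg i = ℚ.toℚᵘ-injective (begin
  toℚᵘ ((ℤ.- i) / 1)   ≈⟨ toℚᵘ-/ (ℤ.- i) 0 ⟩
  mkℚᵘ (ℤ.- i) 0       ≈⟨ ℚᵘ.-‿cong (toℚᵘ-/ i 0) ⟨
  ℚᵘ.- toℚᵘ (i / 1)    ≈⟨ ℚ.toℚᵘ-homo‿- (i / 1) ⟨
  toℚᵘ (- (i / 1))     ∎)
  where open ℚᵘ.≃-Reasoning

/2≡/1*½ : ∀ i → i / 2 ≡ i / 1 * ½
/2≡/1*½ i = ℚ.toℚᵘ-injective (begin
  toℚᵘ (i / 2)                 ≈⟨ toℚᵘ-/ i 1 ⟩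
  mkℚᵘ i 1                     ≈⟨ *≡* (cong (ℤ._* + 2) (ℤ.*-identityʳ i)) ⟨
  mkℚᵘ i 0 ℚᵘ.* mkℚᵘ (+ 1) 1   ≈⟨ ℚᵘ.*-cong (toℚᵘ-/ i 0) (toℚᵘ-/ (+ 1) 1) ⟨
  toℚᵘ (i / 1) ℚᵘ.* toℚᵘ ½     ≈⟨ ℚ.toℚᵘ-homo-* (i / 1) ½ ⟨
  toℚᵘ (i / 1 * ½)             ∎)
  where open ℚᵘ.≃-Reasoning

ι-suc : ∀ k → ι (suc k) ≡ 1ℚ + ι k
ι-suc k = /1-homo-+ (+ 1) (+ k)

ι*inv : ∀ k d → ι k * inv (suc d) ≡ + k / suc d
ι*inv k d = ℚ.toℚᵘ-injective (begin
  toℚᵘ (ι k * inv (suc d))             ≈⟨ ℚ.toℚᵘ-homo-* (ι k) (inv (suc d)) ⟩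
  toℚᵘ (ι k) ℚᵘ.* toℚᵘ (inv (suc d))   ≈⟨ ℚᵘ.*-cong (toℚᵘ-/ (+ k) 0) (toℚᵘ-/ (+ 1) d) ⟩
  mkℚᵘ (+ k) 0 ℚᵘ.* mkℚᵘ (+ 1) d       ≈⟨ *≡* cross ⟩
  mkℚᵘ (+ k) d                         ≈⟨ toℚᵘ-/ (+ k) d ⟨
  toℚᵘ (+ k / suc d)                   ∎)
  where
  open ℚᵘ.≃-Reasoning
  cross : (+ k ℤ.* + 1) ℤ.* + suc d ≡ + k ℤ.* + (1 ℕ.* suc d)
  cross = cong₂ ℤ._*_ (ℤ.*-identityʳ (+ k)) (cong +_ (sym (ℕ.*-identityˡ (suc d))))

ι*inv-cancel : ∀ {k} → 0 ℕ.< k → ι k * inv k ≡ 1ℚ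
ι*inv-cancel {suc k} _ = trans (ι*inv (suc k) k) (/-≡-cross (suc k) 1 k 0 (ℕ.*-comm (suc k) 1))

ι*inv≤1 : ∀ k → ι k * inv k ≤ 1ℚ
ι*inv≤1 zero    = /-≤-cross 0 1 0 0 z≤n
ι*inv≤1 (suc k) = ℚ.≤-reflexive (ι*inv-cancel {suc k} (s≤s z≤n))

inv-nonneg : ∀ k → 0ℚ ≤ inv k
inv-nonneg zero    = ℚ.≤-refl
inv-nonneg (suc k) = /-≤-cross 0 1 0 k z≤n

inv-antimono : ∀ {m n} → 0 ℕ.< m → m ℕ.≤ n → inv n ≤ inv m
inv-antimono {suc m} {suc n} _ m≤n = /-≤-cross 1 1 n m (ℕ.*-monoʳ-≤ 1 m≤n)

inv≤inv+ι*inv : ∀ {a} → 0 ℕ.< a → ∀ b → inv a ≤ inv (a ℕ.+ b) + ι b * inv (a ℕ.+ b)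
inv≤inv+ι*inv {suc a} _ b = begin
  inv (suc a)                       ≤⟨ /-≤-cross 1 (suc b) a t 1+t≤[1+b][1+a] ⟩
  + suc b / suc t                   ≡⟨ ι*inv (suc b) t ⟨
  ι (suc b) * inv (suc t)           ≡⟨ cong (_* inv (suc t)) (ι-suc b) ⟩
  (1ℚ + ι b) * inv (suc t)          ≡⟨ solve 2 (λ b i → (con 1ℚ :+ b) :* i := i :+ b :* i) refl (ι b) (inv (suc t)) ⟩
  inv (suc t) + ι b * inv (suc t)   ∎
  where
  open ℚ.≤-Reasoning
  open ℚ-Solver
  t = a ℕ.+ b
  1+t≤[1+b][1+a] : 1 ℕ.* suc t ℕ.≤ suc b ℕ.* suc a
  1+t≤[1+b][1+a] = ℕ.≤-trans (ℕ.≤-reflexive (ℕ.*-identityˡ (suc t)))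
                             (s≤s (ℕ.+-monoʳ-≤ a (ℕ.m≤m*n b (suc a))))

half-≤ : ∀ i {p} → i / 1 ≤ p + p → i / 2 ≤ p
half-≤ i {p} i≤2p = begin
  i / 2         ≡⟨ /2≡/1*½ i ⟩
  i / 1 * ½     ≤⟨ ℚ.*-monoʳ-≤-nonNeg ½ i≤2p ⟩
  (p + p) * ½   ≡⟨ solve 1 (λ x → (x :+ x) :* con ½ := x) refl p ⟩
  p             ∎
  where open ℚ.≤-Reasoning
        open ℚ-Solver

sub-half-≤ : ∀ m k {p} → ι m ≤ ι k + (p + p) → (+ m ℤ.- + k) / 2 ≤ p
sub-half-≤ m k {p} m≤k+2p = half-≤ (+ m ℤ.- + k) (begin
  (+ m ℤ.- + k) / 1     ≡⟨ /1-homo-+ (+ m) (ℤ.- + k) ⟩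
  ι m + (ℤ.- + k) / 1   ≡⟨ cong (_+_ (ι m)) (/1-homo-neg (+ k)) ⟩
  ι m - ι k             ≤⟨ ℚ.+-monoˡ-≤ (- ι k) m≤k+2p ⟩
  ι k + (p + p) - ι k   ≡⟨ solve 2 (λ k p → k :+ (p :+ p) :- k := p :+ p) refl (ι k) p ⟩
  p + p                 ∎)
  where open ℚ.≤-Reasoning
        open ℚ-Solver

-- Finite sums and counting

∑-mono-≤ : ∀ {n} {f g : Fin n → ℚ} → (∀ i → f i ≤ g i) → sum f ≤ sum g
∑-mono-≤ {zero}  f≤g = ℚ.≤-refl
∑-mono-≤ {suc n} f≤g = ℚ.+-mono-≤ (f≤g zero) (∑-mono-≤ (f≤g ∘ suc))

∑-nonneg : ∀ {n} {f : Fin n → ℚ} → (∀ i → 0ℚ ≤ f i) → 0ℚ ≤ sum f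
∑-nonneg {n} {f} 0≤f = subst (_≤ sum f) (sum-replicate-zero n) (∑-mono-≤ 0≤f)

when : Bool → ℚ → ℚ
when b q = if b then q else 0ℚ

when-split : ∀ b q → when (not b) q + when b q ≡ q
when-split true  q = ℚ.+-identityˡ q
when-split false q = ℚ.+-identityʳ q

when-sum : ∀ {n} b (f : Fin n → ℚ) → when b (sum f) ≡ ∑[ i < n ] when b (f i)
when-sum     true  f = refl
when-sum {n} false f = sym (sum-replicate-zero n)

when-nonneg : ∀ b {q} → 0ℚ ≤ q → 0ℚ ≤ when b q
when-nonneg true  0≤q = 0≤q
when-nonneg false _   = ℚ.≤-refl

when-0<ᵇ : ∀ k q → when (0 <ᵇ k) q ≡ ι k * (inv k * q)
when-0<ᵇ zero    q = sym (ℚ.*-zeroˡ (inv 0 * q))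
when-0<ᵇ (suc k) q = sym (begin
  ι (suc k) * (inv (suc k) * q)   ≡⟨ ℚ.*-assoc (ι (suc k)) (inv (suc k)) q ⟨
  ι (suc k) * inv (suc k) * q     ≡⟨ cong (_* q) (ι*inv-cancel {suc k} (s≤s z≤n)) ⟩
  1ℚ * q                          ≡⟨ ℚ.*-identityˡ q ⟩
  q                               ∎)
  where open ≡-Reasoning

0<ᵇ⇒0< : ∀ {k} → (0 <ᵇ k) ≡ true → 0 ℕ.< k
0<ᵇ⇒0< {suc k} _ = s≤s z≤n

0<⇒0<ᵇ : ∀ {k} → 0 ℕ.< k → (0 <ᵇ k) ≡ true
0<⇒0<ᵇ {suc k} _ = refl

count : ∀ {n} → (Fin n → Bool) → ℕ
count {zero}  p = 0
count {suc n} p = if p zero then suc (count (p ∘ suc)) else count (p ∘ suc)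

∑-when : ∀ {n} (p : Fin n → Bool) q → ∑[ i < n ] when (p i) q ≡ ι (count p) * q
∑-when {zero}  p q = sym (ℚ.*-zeroˡ q)
∑-when {suc n} p q with p zero
... | true  = begin
  q + ∑[ i < n ] when (p (suc i)) q   ≡⟨ cong (_+_ q) (∑-when (p ∘ suc) q) ⟩
  q + ι k * q                         ≡⟨ solve 2 (λ q k → q :+ k :* q := (con 1ℚ :+ k) :* q) refl q (ι k) ⟩
  (1ℚ + ι k) * q                      ≡⟨ cong (_* q) (ι-suc k) ⟨
  ι (suc k) * q                       ∎
  where open ≡-Reasoning
        open ℚ-Solver
        k = count (p ∘ suc)
... | false = trans (ℚ.+-identityˡ _) (∑-when (p ∘ suc) q)

count-true : ∀ {n} → count {n} (λ _ → true) ≡ n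
count-true {zero}  = refl
count-true {suc n} = cong suc count-true

∑-const : ∀ {n} q → ∑[ i < n ] q ≡ ι n * q
∑-const {n} q = trans (∑-when {n} (λ _ → true) q) (cong (λ k → ι k * q) (count-true {n}))

∑-δ : ∀ {n} (a : Fin n) (h : Fin n → ℚ) → ∑[ b < n ] when (does (a ≟ b)) (h b) ≡ h a
∑-δ {suc n} zero    h = trans (cong (_+_ (h zero)) (sum-replicate-zero n)) (ℚ.+-identityʳ (h zero))
∑-δ {suc n} (suc a) h = trans (ℚ.+-identityˡ _) (∑-δ a (h ∘ suc))

count-cong : ∀ {n} {p q : Fin n → Bool} → (∀ i → p i ≡ q i) → count p ≡ count q
count-cong {zero}          p≗q = refl
count-cong {suc n} {p} {q} p≗q rewrite p≗q zero | count-cong {p = p ∘ suc} {q ∘ suc} (p≗q ∘ suc) = refl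

count-mono : ∀ {n} {p q : Fin n → Bool} → (∀ i → p i ≡ true → q i ≡ true) → count p ℕ.≤ count q
count-mono {zero}          p⇒q = z≤n
count-mono {suc n} {p} {q} p⇒q with p zero in p₀ | q zero in q₀
... | false | false = count-mono (p⇒q ∘ suc)
... | false | true  = ℕ.m≤n⇒m≤1+n (count-mono (p⇒q ∘ suc))
... | true  | true  = s≤s (count-mono (p⇒q ∘ suc))
... | true  | false with () ← trans (sym (p⇒q zero p₀)) q₀

count-strict : ∀ {n} {p q : Fin n → Bool} → (∀ i → p i ≡ true → q i ≡ true) →
               ∀ i → p i ≡ false → q i ≡ true → count p ℕ.< count q
count-strict {p = p} {q} p⇒q zero pᵢ qᵢ rewrite pᵢ | qᵢ = s≤s (count-mono (p⇒q ∘ suc))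
count-strict {p = p} {q} p⇒q (suc i) pᵢ qᵢ with p zero in p₀ | q zero in q₀
... | true  | true  = s≤s (count-strict (p⇒q ∘ suc) i pᵢ qᵢ)
... | false | true  = ℕ.m<n⇒m<1+n (count-strict (p⇒q ∘ suc) i pᵢ qᵢ)
... | false | false = count-strict (p⇒q ∘ suc) i pᵢ qᵢ
... | true  | false with () ← trans (sym (p⇒q zero p₀)) q₀

count-pos : ∀ {n} {p : Fin n → Bool} i → p i ≡ true → 0 ℕ.< count p
count-pos {p = p} zero    pᵢ rewrite pᵢ = s≤s z≤n
count-pos {p = p} (suc i) pᵢ with p zero
... | true  = s≤s z≤n
... | false = count-pos i pᵢ

count-two : ∀ {n} {p : Fin n → Bool} i j → i ≢ j → p i ≡ true → p j ≡ true → 2 ℕ.≤ count p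
count-two         zero    zero    i≢j _  _  = contradiction refl i≢j
count-two {p = p} zero    (suc j) _   pᵢ pⱼ rewrite pᵢ = s≤s (count-pos j pⱼ)
count-two {p = p} (suc i) zero    _   pᵢ pⱼ rewrite pⱼ = s≤s (count-pos i pᵢ)
count-two {p = p} (suc i) (suc j) i≢j pᵢ pⱼ with p zero
... | true  = ℕ.m≤n⇒m≤1+n (count-two i j (i≢j ∘ cong suc) pᵢ pⱼ)
... | false = count-two i j (i≢j ∘ cong suc) pᵢ pⱼ

count-zero : ∀ {n} {p : Fin n → Bool} → (∀ i → p i ≡ false) → count p ≡ 0
count-zero {zero}      p≡f = refl
count-zero {suc n} {p} p≡f rewrite p≡f zero = count-zero (p≡f ∘ suc)

count-≟ : ∀ {n} (x : Fin n) → count (λ z → does (z ≟ x)) ≡ 1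
count-≟ {suc n} zero    = cong suc (count-zero {n} (λ _ → refl))
count-≟ {suc n} (suc x) = count-≟ x

count-split : ∀ {n} (p q : Fin n → Bool) →
              count p ≡ count (λ i → p i ∧ q i) ℕ.+ count (λ i → p i ∧ not (q i))
count-split {zero}  p q = refl
count-split {suc n} p q with p zero | q zero | count-split (p ∘ suc) (q ∘ suc)
... | true  | true  | split = cong suc split
... | true  | false | split = trans (cong suc split) (sym (ℕ.+-suc _ _))
... | false | _     | split = split

∣∣≡count : ∀ {n} (S : Subset n) → ∣ S ∣ ≡ count (lookup S)
∣∣≡count []          = refl
∣∣≡count (true ∷ S)  = cong suc (∣∣≡count S)
∣∣≡count (false ∷ S) = ∣∣≡count S

-- Labellings of the vertices

fibreSize : ∀ {n k} → (Fin n → Fin k) → Fin k → ℕ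
fibreSize ρ l = count (λ z → does (ρ z ≟ l))

classSize : ∀ {n k} → (Fin n → Fin k) → Fin n → ℕ
classSize ρ x = fibreSize ρ (ρ x)

classSize-pos : ∀ {n k} (ρ : Fin n → Fin k) x → 0 ℕ.< classSize ρ x
classSize-pos ρ x = count-pos {p = λ z → does (ρ z ≟ ρ x)} x (dec-true (ρ x ≟ ρ x) refl)

meetSize : ∀ {n k} → (Fin n → Fin k) → (Fin n → Bool) → Fin k → ℕ
meetSize ρ S l = count (λ z → S z ∧ does (l ≟ ρ z))

same : ∀ {n k} → (Fin n → Fin k) → Fin n → Fin n → Bool
same ρ x y = does (ρ x ≟ ρ y)

classCount : ∀ {n k} → (Fin n → Fin k) → ℕ
classCount ρ = count (λ l → 0 <ᵇ fibreSize ρ l)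

classTerm : ∀ {n k} → (Fin n → Fin k) → ℚ
classTerm {n} ρ = ∑[ x < n ] inv (classSize ρ x)

innerWeight : ∀ {n k} → (Fin n → Fin n → ℚ) → (Fin n → Fin k) → ℚ
innerWeight {n} w ρ = ∑[ x < n ] ∑[ y < n ] when (same ρ x y) (w x y)

potential : ∀ {n k} → (Fin n → Fin n → ℚ) → (Fin n → Fin k) → ℚ
potential w ρ = classTerm ρ + innerWeight w ρ

classTerm≤ : ∀ {n k} (ρ : Fin n → Fin k) → classTerm ρ ≤ ι k
classTerm≤ {n} {k} ρ = begin
  ∑[ x < n ] inv (N (ρ x))                        ≡⟨ sum-cong-≗ (λ x → ∑-δ (ρ x) (inv ∘ N)) ⟨
  ∑[ x < n ] ∑[ l < k ] on-fibre x l              ≡⟨ ∑-comm on-fibre ⟩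
  ∑[ l < k ] ∑[ x < n ] on-fibre x l              ≡⟨ sum-cong-≗ (λ l → ∑-when (λ x → does (ρ x ≟ l)) (inv (N l))) ⟩
  ∑[ l < k ] (ι (N l) * inv (N l))                ≤⟨ ∑-mono-≤ (λ l → ι*inv≤1 (N l)) ⟩
  ∑[ l < k ] 1ℚ                                   ≡⟨ ∑-const {k} 1ℚ ⟩
  ι k * 1ℚ                                        ≡⟨ ℚ.*-identityʳ (ι k) ⟩
  ι k                                             ∎
  where
  open ℚ.≤-Reasoning
  N = fibreSize ρ
  on-fibre : Fin n → Fin k → ℚ
  on-fibre x l = when (does (ρ x ≟ l)) (inv (N l))

classTerm-id : ∀ {n} → classTerm (id {A = Fin n}) ≡ ι n
classTerm-id {n} = begin
  ∑[ x < n ] inv (classSize id x)   ≡⟨ sum-cong-≗ {n} (λ x → cong inv (count-≟ x)) ⟩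
  ∑[ x < n ] 1ℚ                     ≡⟨ ∑-const {n} 1ℚ ⟩
  ι n * 1ℚ                          ≡⟨ ℚ.*-identityʳ (ι n) ⟩
  ι n                               ∎
  where open ≡-Reasoning

classTerm≤potential : ∀ {n k} {w : Fin n → Fin n → ℚ} → (∀ x y → 0ℚ ≤ w x y) →
                      (ρ : Fin n → Fin k) → classTerm ρ ≤ potential w ρ
classTerm≤potential w≥0 ρ = ℚ.≤-trans (ℚ.≤-reflexive (sym (ℚ.+-identityʳ (classTerm ρ))))
  (ℚ.+-monoʳ-≤ (classTerm ρ) (∑-nonneg λ x → ∑-nonneg λ y → when-nonneg (same ρ x y) (w≥0 x y)))

∑-fibre : ∀ {n k} (ρ : Fin n → Fin k) l (g : Fin k → ℚ) →
          ∑[ x < n ] when (does (ρ x ≟ l)) (g (ρ x)) ≡ ι (fibreSize ρ l) * g l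
∑-fibre ρ l g = trans (sum-cong-≗ on-fibre) (∑-when (λ x → does (ρ x ≟ l)) (g l))
  where
  on-fibre : ∀ x → when (does (ρ x ≟ l)) (g (ρ x)) ≡ when (does (ρ x ≟ l)) (g l)
  on-fibre x with ρ x ≟ l
  ... | yes refl = refl
  ... | no _     = refl

∑-inv-classSize-meeting : ∀ {n k} (ρ : Fin n → Fin k) (S : Fin n → Bool) →
  ∑[ x < n ] when (0 <ᵇ meetSize ρ S (ρ x)) (inv (classSize ρ x)) ≡ ∑[ y < n ] when (S y) (inv (meetSize ρ S (ρ y)))
∑-inv-classSize-meeting {n} ρ S = begin
  ∑[ x < n ] when (0 <ᵇ a (ρ x)) (inv (N (ρ x)))
    ≡⟨ sum-cong-≗ (λ x → when-0<ᵇ (a (ρ x)) _) ⟩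
  ∑[ x < n ] (ι (a (ρ x)) * h (ρ x))
    ≡⟨ sum-cong-≗ (λ x → ∑-when (λ y → S y ∧ does (ρ x ≟ ρ y)) (h (ρ x))) ⟨
  ∑[ x < n ] ∑[ y < n ] when (S y ∧ does (ρ x ≟ ρ y)) (h (ρ x))
    ≡⟨ ∑-comm (λ x y → when (S y ∧ does (ρ x ≟ ρ y)) (h (ρ x))) ⟩
  ∑[ y < n ] ∑[ x < n ] when (S y ∧ does (ρ x ≟ ρ y)) (h (ρ x))
    ≡⟨ sum-cong-≗ column ⟩
  ∑[ y < n ] when (S y) (inv (a (ρ y)))
    ∎
  where
  open ≡-Reasoning
  a = meetSize ρ S
  N = fibreSize ρ
  h : _ → ℚ
  h l = inv (a l) * inv (N l)
  column : ∀ y → ∑[ x < n ] when (S y ∧ does (ρ x ≟ ρ y)) (h (ρ x)) ≡ when (S y) (inv (a (ρ y)))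
  column y with S y
  ... | false = sum-replicate-zero n
  ... | true  = begin
    ∑[ x < n ] when (does (ρ x ≟ ρ y)) (h (ρ x))
      ≡⟨ ∑-fibre ρ (ρ y) h ⟩
    ι (N (ρ y)) * (inv (a (ρ y)) * inv (N (ρ y)))
      ≡⟨ solve 3 (λ m i j → m :* (i :* j) := i :* (m :* j)) refl (ι (N (ρ y))) (inv (a (ρ y))) (inv (N (ρ y))) ⟩
    inv (a (ρ y)) * (ι (N (ρ y)) * inv (N (ρ y)))
      ≡⟨ cong (inv (a (ρ y)) *_) (ι*inv-cancel (classSize-pos ρ y)) ⟩
    inv (a (ρ y)) * 1ℚ
      ≡⟨ ℚ.*-identityʳ (inv (a (ρ y))) ⟩
    inv (a (ρ y))
      ∎
    where open ℚ-Solver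

-- Merging the classes that meet a set

module Merge {n k} (w : Fin n → Fin n → ℚ) (w≥0 : ∀ x y → 0ℚ ≤ w x y)
  (ρ : Fin n → Fin k) (S : Fin n → Bool) {u v : Fin n}
  (u∈S : S u ≡ true) (v∈S : S v ≡ true) (ρu≢ρv : ρ u ≢ ρ v)
  (heavy : ∀ x y → S x ≡ true → S y ≡ true → ρ x ≢ ρ y → inv (count S) ≤ w x y) where

  t : ℕ
  t = count S

  inS : Fin k → ℕ
  inS = meetSize ρ S

  outS : Fin n → ℕ
  outS y = count (λ z → S z ∧ not (does (ρ y ≟ ρ z)))

  meets : Fin n → Bool
  meets x = 0 <ᵇ inS (ρ x)

  merged : Fin n → Fin k
  merged x = if meets x then ρ u else ρ x

  meets-intro : ∀ {x} z → S z ≡ true → ρ z ≡ ρ x → meets x ≡ true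
  meets-intro {x} z z∈S ρz≡ρx = 0<⇒0<ᵇ (count-pos {p = λ y → S y ∧ does (ρ x ≟ ρ y)} z
    (cong₂ _∧_ z∈S (dec-true (ρ x ≟ ρ z) (sym ρz≡ρx))))

  meets-u : meets u ≡ true
  meets-u = meets-intro u u∈S refl

  meets-resp : ∀ {x y} → ρ x ≡ ρ y → meets x ≡ meets y
  meets-resp = cong (λ l → 0 <ᵇ inS l)

  labels-differ : ∀ {x y} → meets x ≡ false → meets y ≡ true → ρ x ≢ ρ y
  labels-differ x∉M y∈M ρx≡ρy with () ← trans (sym x∉M) (trans (meets-resp ρx≡ρy) y∈M)

  merged-resp : ∀ {x y} → ρ x ≡ ρ y → merged x ≡ merged y
  merged-resp ρx≡ρy = cong₂ (λ m l → if m then ρ u else l) (meets-resp ρx≡ρy) ρx≡ρy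

  merged-in : ∀ {x} → meets x ≡ true → merged x ≡ ρ u
  merged-in x∈M rewrite x∈M = refl

  classSize-merged-in : ∀ {x} → meets x ≡ true → classSize merged x ≡ count meets
  classSize-merged-in {x} x∈M = count-cong same-as-meets
    where
    same-as-meets : ∀ z → does (merged z ≟ merged x) ≡ meets z
    same-as-meets z rewrite x∈M with meets z in z∈M
    ... | true  = dec-true (ρ u ≟ ρ u) refl
    ... | false = dec-false (ρ z ≟ ρ u) (labels-differ z∈M meets-u)

  classSize-merged-out : ∀ {x} → meets x ≡ false → classSize merged x ≡ classSize ρ x
  classSize-merged-out {x} x∉M = count-cong same-as-before
    where
    same-as-before : ∀ z → does (merged z ≟ merged x) ≡ does (ρ z ≟ ρ x)
    same-as-before z rewrite x∉M with meets z in z∈M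
    ... | true  = trans (dec-false (ρ u ≟ ρ x) (labels-differ x∉M meets-u ∘ sym))
                        (sym (dec-false (ρ z ≟ ρ x) (labels-differ x∉M z∈M ∘ sym)))
    ... | false = refl

  outside inside : ℚ
  outside = ∑[ x < n ] when (not (meets x)) (inv (classSize ρ x))
  inside  = ∑[ x < n ] when (meets x) (inv (classSize ρ x))

  classTerm-split : classTerm ρ ≡ outside + inside
  classTerm-split = trans (sum-cong-≗ (λ x → sym (when-split (meets x) _)))
    (∑-distrib-+ (λ x → when (not (meets x)) (inv (classSize ρ x))) (λ x → when (meets x) (inv (classSize ρ x))))

  classTerm-merged : classTerm merged ≡ outside + 1ℚ
  classTerm-merged = begin
    classTerm merged
      ≡⟨ sum-cong-≗ split ⟩
    ∑[ x < n ] (when (not (meets x)) (inv (classSize ρ x)) + when (meets x) (inv m))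
      ≡⟨ ∑-distrib-+ (λ x → when (not (meets x)) (inv (classSize ρ x))) (λ x → when (meets x) (inv m)) ⟩
    outside + ∑[ x < n ] when (meets x) (inv m)
      ≡⟨ cong (_+_ outside) (∑-when meets (inv m)) ⟩
    outside + ι m * inv m
      ≡⟨ cong (_+_ outside) (ι*inv-cancel (count-pos {p = meets} u meets-u)) ⟩
    outside + 1ℚ
      ∎
    where
    open ≡-Reasoning
    m = count meets
    split : ∀ x → inv (classSize merged x) ≡ when (not (meets x)) (inv (classSize ρ x)) + when (meets x) (inv m)
    split x with meets x | classSize-merged-in {x} | classSize-merged-out {x}
    ... | true  | sizeIn | _       = trans (cong inv (sizeIn refl)) (sym (ℚ.+-identityˡ _))
    ... | false | _      | sizeOut = trans (cong inv (sizeOut refl)) (sym (ℚ.+-identityʳ _))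

  gain : ℚ
  gain = ∑[ y < n ] when (S y) (ι (outS y) * inv t)

  inside≤1+gain : inside ≤ 1ℚ + gain
  inside≤1+gain = begin
    inside
      ≡⟨ ∑-inv-classSize-meeting ρ S ⟩
    ∑[ y < n ] when (S y) (inv (inS (ρ y)))
      ≤⟨ ∑-mono-≤ pointwise ⟩
    ∑[ y < n ] (when (S y) (inv t) + when (S y) (ι (outS y) * inv t))
      ≡⟨ ∑-distrib-+ (λ y → when (S y) (inv t)) (λ y → when (S y) (ι (outS y) * inv t)) ⟩
    ∑[ y < n ] when (S y) (inv t) + gain
      ≡⟨ cong (_+ gain) (∑-when S (inv t)) ⟩
    ι t * inv t + gain
      ≡⟨ cong (_+ gain) (ι*inv-cancel (count-pos {p = S} u u∈S)) ⟩
    1ℚ + gain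
      ∎
    where
    open ℚ.≤-Reasoning
    pointwise : ∀ y → when (S y) (inv (inS (ρ y))) ≤ when (S y) (inv t) + when (S y) (ι (outS y) * inv t)
    pointwise y with S y in y∈S
    ... | false = ℚ.≤-refl
    ... | true  = subst (λ m → inv (inS (ρ y)) ≤ inv m + ι (outS y) * inv m)
      (sym (count-split S (λ z → does (ρ y ≟ ρ z))))
      (inv≤inv+ι*inv (count-pos {p = λ z → S z ∧ does (ρ y ≟ ρ z)} y (cong₂ _∧_ y∈S (dec-true (ρ y ≟ ρ y) refl)))
                     (outS y))

  innerWeight+gain≤ : innerWeight w ρ + gain ≤ innerWeight w merged
  innerWeight+gain≤ = begin
    innerWeight w ρ + gain
      ≡⟨ cong (_+_ (innerWeight w ρ)) (sum-cong-≗ gain-row) ⟩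
    innerWeight w ρ + ∑[ x < n ] ∑[ y < n ] g x y
      ≡⟨ ∑-distrib-+ (λ x → ∑[ y < n ] f x y) (λ x → ∑[ y < n ] g x y) ⟨
    ∑[ x < n ] (∑[ y < n ] f x y + ∑[ y < n ] g x y)
      ≡⟨ sum-cong-≗ (λ x → ∑-distrib-+ (f x) (g x)) ⟨
    ∑[ x < n ] ∑[ y < n ] (f x y + g x y)
      ≤⟨ ∑-mono-≤ (λ x → ∑-mono-≤ (pointwise x)) ⟩
    innerWeight w merged
      ∎
    where
    open ℚ.≤-Reasoning
    f g : Fin n → Fin n → ℚ
    f x y = when (same ρ x y) (w x y)
    g x y = when (S x) (when (S y ∧ not (same ρ x y)) (inv t))
    gain-row : ∀ x → when (S x) (ι (outS x) * inv t) ≡ ∑[ y < n ] g x y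
    gain-row x = trans (cong (when (S x)) (sym (∑-when (λ y → S y ∧ not (same ρ x y)) (inv t))))
                       (when-sum (S x) (λ y → when (S y ∧ not (same ρ x y)) (inv t)))
    pointwise : ∀ x y → f x y + g x y ≤ when (same merged x y) (w x y)
    pointwise x y with ρ x ≟ ρ y
    ... | yes ρx≡ρy rewrite dec-true (merged x ≟ merged y) (merged-resp ρx≡ρy) | ∧-zeroʳ (S y) with S x
    ...   | true  = ℚ.≤-reflexive (ℚ.+-identityʳ (w x y))
    ...   | false = ℚ.≤-reflexive (ℚ.+-identityʳ (w x y))
    pointwise x y | no ρx≢ρy with S x in x∈S | S y in y∈S
    ... | true  | true  rewrite dec-true (merged x ≟ merged y)
                          (trans (merged-in (meets-intro x x∈S refl)) (sym (merged-in (meets-intro y y∈S refl))))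
                        = ℚ.≤-trans (ℚ.≤-reflexive (ℚ.+-identityˡ _)) (heavy x y x∈S y∈S ρx≢ρy)
    ... | true  | false = ℚ.≤-trans (ℚ.≤-reflexive (ℚ.+-identityˡ _)) (when-nonneg (same merged x y) (w≥0 x y))
    ... | false | _     = ℚ.≤-trans (ℚ.≤-reflexive (ℚ.+-identityˡ _)) (when-nonneg (same merged x y) (w≥0 x y))

  potential-merged : potential w ρ ≤ potential w merged
  potential-merged = begin
    classTerm ρ + W                         ≡⟨ cong (_+ W) classTerm-split ⟩
    (outside + inside) + W                  ≤⟨ ℚ.+-monoˡ-≤ W (ℚ.+-monoʳ-≤ outside inside≤1+gain) ⟩
    (outside + (1ℚ + gain)) + W             ≡⟨ solve 4 (λ o i g w → (o :+ (i :+ g)) :+ w := (o :+ i) :+ (w :+ g))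
                                                       refl outside 1ℚ gain W ⟩
    (outside + 1ℚ) + (W + gain)             ≤⟨ ℚ.+-monoʳ-≤ (outside + 1ℚ) innerWeight+gain≤ ⟩
    (outside + 1ℚ) + innerWeight w merged   ≡⟨ cong (_+ innerWeight w merged) classTerm-merged ⟨
    potential w merged                      ∎
    where
    open ℚ.≤-Reasoning
    open ℚ-Solver
    W = innerWeight w ρ

  classCount-merged : classCount merged ℕ.< classCount ρ
  classCount-merged =
    count-strict used-before (ρ v) (cong (0 <ᵇ_) (count-zero unused)) (0<⇒0<ᵇ (classSize-pos ρ v))
    where
    unused : ∀ z → does (merged z ≟ ρ v) ≡ false
    unused z with meets z in z∈M
    ... | true  = dec-false (ρ u ≟ ρ v) ρu≢ρv
    ... | false = dec-false (ρ z ≟ ρ v) (labels-differ z∈M (meets-intro v v∈S refl))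
    used-before : ∀ l → (0 <ᵇ fibreSize merged l) ≡ true → (0 <ᵇ fibreSize ρ l) ≡ true
    used-before l used with l ≟ ρ u
    ... | yes refl = 0<⇒0<ᵇ (classSize-pos ρ u)
    ... | no l≢ρu  = 0<⇒0<ᵇ (ℕ.<-≤-trans (0<ᵇ⇒0< used) (count-mono kept))
      where
      kept : ∀ z → does (merged z ≟ l) ≡ true → does (ρ z ≟ l) ≡ true
      kept z with meets z
      ... | true  = λ ρu≟l → contradiction (trans (sym ρu≟l) (dec-false (ρ u ≟ l) (l≢ρu ∘ sym))) λ ()
      ... | false = id

-- Edge sums

sumℚ-tabulate : ∀ {m n} (g : Fin n → ℚ) (h : Fin m → Fin n) → sumℚ (map g (tabulate h)) ≡ ∑[ i < m ] g (h i)
sumℚ-tabulate {zero}  g h = refl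
sumℚ-tabulate {suc m} g h = cong (_+_ (g (h zero))) (sumℚ-tabulate g (h ∘ suc))

module _ {n} (G : Graph n) where

  adjWeight : ((i j : Fin n) → Adj G i j → ℚ) → Fin n → Fin n → ℚ
  adjWeight W x y with adj? G x y
  ... | yes a = W x y a
  ... | no _  = 0ℚ

  module _ (W : (i j : Fin n) → Adj G i j → ℚ) (W-sym : ∀ x y a b → W x y a ≡ W y x b) where

    -- The summand of edgeSum is local to its definition; unification names it upper.
    mutual
      upper : Fin n → Fin n → ℚ
      upper = _

      edgeSum≡∑∑upper : edgeSum G W ≡ ∑[ i < n ] ∑[ j < n ] upper i j
      edgeSum≡∑∑upper = trans (sumℚ-tabulate (λ i → sumℚ (map (upper i) (allFin n))) id)
                              (sum-cong-≗ (λ i → sumℚ-tabulate (upper i) id))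

    upper-< : ∀ {i j} → i Fin.< j → upper i j ≡ adjWeight W i j
    upper-< {i} {j} i<j with i <? j | adj? G i j
    ... | yes _  | yes _ = refl
    ... | yes _  | no _  = refl
    ... | no i≮j | _     = contradiction i<j i≮j

    upper-≮ : ∀ {i j} → ¬ i Fin.< j → upper i j ≡ 0ℚ
    upper-≮ {i} {j} i≮j with i <? j
    ... | yes i<j = contradiction i<j i≮j
    ... | no _    = refl

    adjWeight-sym : ∀ x y → adjWeight W x y ≡ adjWeight W y x
    adjWeight-sym x y with adj? G x y | adj? G y x
    ... | yes a | yes b = W-sym x y a b
    ... | yes a | no ¬b = contradiction (Graph.sym G a) ¬b
    ... | no ¬a | yes b = contradiction (Graph.sym G b) ¬a
    ... | no _  | no _  = refl

    adjWeight-diag : ∀ x → adjWeight W x x ≡ 0ℚ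
    adjWeight-diag x with adj? G x x
    ... | yes a = contradiction a (irrefl G)
    ... | no _  = refl

    adjWeight≡upper+upper : ∀ x y → adjWeight W x y ≡ upper x y + upper y x
    adjWeight≡upper+upper x y with Fin.<-cmp x y
    ... | tri< x<y _ y≮x rewrite upper-< x<y | upper-≮ y≮x = sym (ℚ.+-identityʳ _)
    ... | tri> x≮y _ y<x rewrite upper-≮ x≮y | upper-< y<x = trans (adjWeight-sym x y) (sym (ℚ.+-identityˡ _))
    ... | tri≈ x≮x refl _ rewrite upper-≮ x≮x | adjWeight-diag x = refl

    ∑∑adjWeight≡edgeSum+edgeSum : ∑[ x < n ] ∑[ y < n ] adjWeight W x y ≡ edgeSum G W + edgeSum G W
    ∑∑adjWeight≡edgeSum+edgeSum = begin
      ∑[ x < n ] ∑[ y < n ] adjWeight W x y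
        ≡⟨ sum-cong-≗ (λ x → sum-cong-≗ (adjWeight≡upper+upper x)) ⟩
      ∑[ x < n ] ∑[ y < n ] (upper x y + upper y x)
        ≡⟨ sum-cong-≗ (λ x → ∑-distrib-+ (upper x) (λ y → upper y x)) ⟩
      ∑[ x < n ] (∑[ y < n ] upper x y + ∑[ y < n ] upper y x)
        ≡⟨ ∑-distrib-+ (λ x → ∑[ y < n ] upper x y) (λ x → ∑[ y < n ] upper y x) ⟩
      ∑[ x < n ] ∑[ y < n ] upper x y + ∑[ x < n ] ∑[ y < n ] upper y x
        ≡⟨ cong (_+_ (∑[ x < n ] ∑[ y < n ] upper x y)) (∑-comm (λ x y → upper y x)) ⟩
      ∑[ x < n ] ∑[ y < n ] upper x y + ∑[ y < n ] ∑[ x < n ] upper y x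
        ≡⟨ cong₂ _+_ edgeSum≡∑∑upper edgeSum≡∑∑upper ⟨
      edgeSum G W + edgeSum G W
        ∎
      where open ≡-Reasoning

-- Cliques

argmax₂ : ∀ {n} (f : Fin n → Fin n → ℕ) → Fin n → ∃₂ λ u v → ∀ x y → f x y ℕ.≤ f u v
argmax₂ {n} f x₀ = proj₁ best , proj₂ best , λ x y →
    All.lookup (f[xs]≤f[argmax] (x₀ , x₀) pairs) (∈-cartesianProduct⁺ (∈-allFin x) (∈-allFin y))
  where
  pairs = cartesianProduct (allFin n) (allFin n)
  best  = argmax (uncurry f) (x₀ , x₀) pairs

module Cliques {n} (G : Graph n) (cl : (i j : Fin n) → Adj G i j → ℕ)
  (isCl : (i j : Fin n) (a : Adj G i j) → IsCl G i j (cl i j a)) where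

  adjacent : Fin n → Fin n → Bool
  adjacent x y = does (adj? G x y)

  deg : Fin n → ℕ
  deg x = count (adjacent x)

  maxClique : ∀ x y → Adj G x y → Subset n
  maxClique x y a = proj₁ (proj₁ (isCl x y a))

  maxClique-isClique : ∀ x y a → IsClique G (maxClique x y a)
  maxClique-isClique x y a = proj₁ (proj₂ (proj₁ (isCl x y a)))

  ∈maxCliqueˡ : ∀ x y a → x ∈ maxClique x y a
  ∈maxCliqueˡ x y a = proj₁ (proj₂ (proj₂ (proj₁ (isCl x y a))))

  ∈maxCliqueʳ : ∀ x y a → y ∈ maxClique x y a
  ∈maxCliqueʳ x y a = proj₁ (proj₂ (proj₂ (proj₂ (proj₁ (isCl x y a)))))

  ∣maxClique∣ : ∀ x y a → ∣ maxClique x y a ∣ ≡ cl x y a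
  ∣maxClique∣ x y a = proj₂ (proj₂ (proj₂ (proj₂ (proj₁ (isCl x y a)))))

  clique≤cl : ∀ x y a S → IsClique G S → x ∈ S → y ∈ S → ∣ S ∣ ℕ.≤ cl x y a
  clique≤cl x y a = proj₂ (isCl x y a)

  cl-sym : ∀ x y a b → cl x y a ≡ cl y x b
  cl-sym x y a b = ℕ.≤-antisym
    (subst (ℕ._≤ cl y x b) (∣maxClique∣ x y a)
      (clique≤cl y x b _ (maxClique-isClique x y a) (∈maxCliqueʳ x y a) (∈maxCliqueˡ x y a)))
    (subst (ℕ._≤ cl x y a) (∣maxClique∣ y x b)
      (clique≤cl x y a _ (maxClique-isClique y x b) (∈maxCliqueʳ y x b) (∈maxCliqueˡ y x b)))

  cl-irrelevant : ∀ x y a b → cl x y a ≡ cl x y b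
  cl-irrelevant x y a b = trans (cl-sym x y a (Graph.sym G b)) (sym (cl-sym x y b (Graph.sym G b)))

  2≤∣clique∣ : ∀ {S : Subset n} {x y} → x ∈ S → y ∈ S → x ≢ y → 2 ℕ.≤ ∣ S ∣
  2≤∣clique∣ {S} x∈S y∈S x≢y =
    subst (2 ℕ.≤_) (sym (∣∣≡count S)) (count-two _ _ x≢y ([]=⇒lookup x∈S) ([]=⇒lookup y∈S))

  ∣clique∣≤1+deg : ∀ {S x} → IsClique G S → x ∈ S → ∣ S ∣ ℕ.≤ suc (deg x)
  ∣clique∣≤1+deg {S} {x} S-clique x∈S = begin
    ∣ S ∣
      ≡⟨ ∣∣≡count S ⟩
    count (lookup S)
      ≡⟨ count-split (lookup S) (λ z → does (z ≟ x)) ⟩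
    count (λ z → lookup S z ∧ does (z ≟ x)) ℕ.+ count (λ z → lookup S z ∧ not (does (z ≟ x)))
      ≤⟨ ℕ.+-mono-≤ (count-mono is-x) (count-mono neighbour) ⟩
    count (λ z → does (z ≟ x)) ℕ.+ deg x
      ≡⟨ cong (ℕ._+ deg x) (count-≟ x) ⟩
    suc (deg x)
      ∎
    where
    open ℕ.≤-Reasoning
    is-x : ∀ z → (lookup S z ∧ does (z ≟ x)) ≡ true → does (z ≟ x) ≡ true
    is-x z with lookup S z
    ... | true  = id
    ... | false = λ ()
    neighbour : ∀ z → (lookup S z ∧ not (does (z ≟ x))) ≡ true → adjacent x z ≡ true
    neighbour z with lookup S z in z∈S | z ≟ x
    ... | true  | no z≢x = λ _ → dec-true (adj? G x z) (S-clique x z x∈S (lookup⇒[]= z S z∈S) (z≢x ∘ sym))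
    ... | true  | yes _  = λ ()
    ... | false | _      = λ ()

  2≤cl : ∀ x y a → 2 ℕ.≤ cl x y a
  2≤cl x y a = subst (2 ℕ.≤_) (∣maxClique∣ x y a)
    (2≤∣clique∣ (∈maxCliqueˡ x y a) (∈maxCliqueʳ x y a) (λ { refl → irrefl G a }))

  cl≤1+deg : ∀ x y a → cl x y a ℕ.≤ suc (deg x)
  cl≤1+deg x y a = subst (ℕ._≤ suc (deg x)) (∣maxClique∣ x y a)
    (∣clique∣≤1+deg (maxClique-isClique x y a) (∈maxCliqueˡ x y a))

  W₁ W₂ : (i j : Fin n) → Adj G i j → ℚ
  W₁ i j a = inv (cl i j a ∸ 1)
  W₂ i j a = inv (cl i j a)

  module _ (noIsolated : NoIsolated G) where

    deg-pos : ∀ x → 0 ℕ.< deg x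
    deg-pos x = count-pos (proj₁ (noIsolated x)) (dec-true (adj? G x _) (proj₂ (noIsolated x)))

    1≤∑adjWeight₁ : ∀ x → 1ℚ ≤ ∑[ y < n ] adjWeight G W₁ x y
    1≤∑adjWeight₁ x = begin
      1ℚ                                             ≡⟨ ι*inv-cancel (deg-pos x) ⟨
      ι (deg x) * inv (deg x)                        ≡⟨ ∑-when (adjacent x) (inv (deg x)) ⟨
      ∑[ y < n ] when (adjacent x y) (inv (deg x))   ≤⟨ ∑-mono-≤ pointwise ⟩
      ∑[ y < n ] adjWeight G W₁ x y                  ∎
      where
      open ℚ.≤-Reasoning
      pointwise : ∀ y → when (adjacent x y) (inv (deg x)) ≤ adjWeight G W₁ x y
      pointwise y with adj? G x y
      ... | yes a = inv-antimono (ℕ.∸-monoˡ-≤ 1 (2≤cl x y a)) (ℕ.∸-monoˡ-≤ 1 (cl≤1+deg x y a))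
      ... | no _  = ℚ.≤-refl

    n≤edgeSum₁+edgeSum₁ : ι n ≤ edgeSum G W₁ + edgeSum G W₁
    n≤edgeSum₁+edgeSum₁ = begin
      ι n                                         ≡⟨ ℚ.*-identityʳ (ι n) ⟨
      ι n * 1ℚ                                    ≡⟨ ∑-const {n} 1ℚ ⟨
      ∑[ x < n ] 1ℚ                               ≤⟨ ∑-mono-≤ 1≤∑adjWeight₁ ⟩
      ∑[ x < n ] ∑[ y < n ] adjWeight G W₁ x y    ≡⟨ ∑∑adjWeight≡edgeSum+edgeSum G W₁ W₁-sym ⟩
      edgeSum G W₁ + edgeSum G W₁                 ∎
      where
      open ℚ.≤-Reasoning
      W₁-sym : ∀ x y a b → W₁ x y a ≡ W₁ y x b
      W₁-sym x y a b = cong (λ k → inv (k ∸ 1)) (cl-sym x y a b)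

  w₂ : Fin n → Fin n → ℚ
  w₂ = adjWeight G W₂

  w₂-nonneg : ∀ x y → 0ℚ ≤ w₂ x y
  w₂-nonneg x y with adj? G x y
  ... | yes a = inv-nonneg (cl x y a)
  ... | no _  = ℚ.≤-refl

  w₂-adj : ∀ {x y} (b : Adj G x y) → w₂ x y ≡ inv (cl x y b)
  w₂-adj {x} {y} b with adj? G x y
  ... | yes a = cong inv (cl-irrelevant x y a b)
  ... | no ¬b = contradiction b ¬b

  NoCrossEdge : (Fin n → Fin n) → Set
  NoCrossEdge ρ = ∀ x y → Adj G x y → ρ x ≡ ρ y

  record HeaviestCrossEdge (ρ : Fin n → Fin n) : Set where
    field
      u v      : Fin n
      adj      : Adj G u v
      cross    : ρ u ≢ ρ v
      heaviest : ∀ x y (b : Adj G x y) → ρ x ≢ ρ y → cl x y b ℕ.≤ cl u v adj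

  crossScore : ∀ (ρ : Fin n → Fin n) {x y} → Dec (Adj G x y) → Dec (ρ x ≡ ρ y) → ℕ
  crossScore ρ (yes a) (no _)  = suc (cl _ _ a)
  crossScore ρ (yes _) (yes _) = 0
  crossScore ρ (no _)  _       = 0

  heaviestCrossEdge? : Fin n → ∀ ρ → NoCrossEdge ρ ⊎ HeaviestCrossEdge ρ
  heaviestCrossEdge? x₀ ρ = let (u , v , max) = argmax₂ score x₀ in classify (adj? G u v) (ρ u ≟ ρ v) max
    where
    score : Fin n → Fin n → ℕ
    score x y = crossScore ρ (adj? G x y) (ρ x ≟ ρ y)

    score-cross : ∀ {x y} (b : Adj G x y) → ρ x ≢ ρ y → score x y ≡ suc (cl x y b)
    score-cross {x} {y} b ρx≢ρy with adj? G x y | ρ x ≟ ρ y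
    ... | yes a | no _      = cong suc (cl-irrelevant x y a b)
    ... | yes _ | yes ρx≡ρy = contradiction ρx≡ρy ρx≢ρy
    ... | no ¬b | _         = contradiction b ¬b

    none : (∀ x y → score x y ℕ.≤ 0) → NoCrossEdge ρ
    none max x y b with ρ x ≟ ρ y
    ... | yes ρx≡ρy = ρx≡ρy
    ... | no ρx≢ρy  = contradiction (subst (ℕ._≤ 0) (score-cross b ρx≢ρy) (max x y)) λ ()

    classify : ∀ {u v} (d : Dec (Adj G u v)) (e : Dec (ρ u ≡ ρ v)) →
               (∀ x y → score x y ℕ.≤ crossScore ρ d e) → NoCrossEdge ρ ⊎ HeaviestCrossEdge ρ
    classify {u} {v} (yes a) (no ρu≢ρv) max = inj₂ (record
      { u = u ; v = v ; adj = a ; cross = ρu≢ρv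
      ; heaviest = λ x y b ρx≢ρy → ℕ.≤-pred (subst (ℕ._≤ _) (score-cross b ρx≢ρy) (max x y)) })
    classify (yes _) (yes _) max = inj₁ (none max)
    classify (no _)  _       max = inj₁ (none max)

  connected⇒sameLabel : ∀ {ρ : Fin n → Fin n} → NoCrossEdge ρ → ∀ {x y} → Connected G x y → ρ x ≡ ρ y
  connected⇒sameLabel noCross ε        = refl
  connected⇒sameLabel noCross (a ◅ xy) = trans (noCross _ _ a) (connected⇒sameLabel noCross xy)

  module _ {c} (f : Fin n → Fin c) (f⇒connected : ∀ x y → f x ≡ f y → Connected G x y) where

    bound : ℚ
    bound = ι c + ∑[ x < n ] ∑[ y < n ] w₂ x y

    potential-noCross : ∀ ρ → NoCrossEdge ρ → potential w₂ ρ ≤ bound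
    potential-noCross ρ noCross = ℚ.+-mono-≤ (ℚ.≤-trans classTerm-mono (classTerm≤ f))
                                              (ℚ.≤-reflexive (sum-cong-≗ (λ x → sum-cong-≗ (inner x))))
      where
      component⊆class : ∀ x z → does (f z ≟ f x) ≡ true → does (ρ z ≟ ρ x) ≡ true
      component⊆class x z with f z ≟ f x
      ... | yes fz≡fx = λ _ → dec-true (ρ z ≟ ρ x) (connected⇒sameLabel noCross (f⇒connected z x fz≡fx))
      ... | no _      = λ ()
      classTerm-mono : classTerm ρ ≤ classTerm f
      classTerm-mono = ∑-mono-≤ λ x → inv-antimono (classSize-pos f x) (count-mono (component⊆class x))
      inner : ∀ x y → when (same ρ x y) (w₂ x y) ≡ w₂ x y
      inner x y with adj? G x y
      ... | yes b rewrite dec-true (ρ x ≟ ρ y) (noCross x y b) = refl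
      ... | no _ with same ρ x y
      ...   | true  = refl
      ...   | false = refl

    potential≤bound : ∀ x₀ ρ → Acc ℕ._<_ (classCount ρ) → potential w₂ ρ ≤ bound
    potential≤bound x₀ ρ (acc rec) with heaviestCrossEdge? x₀ ρ
    ... | inj₁ noCross = potential-noCross ρ noCross
    ... | inj₂ h       = ℚ.≤-trans potential-merged (potential≤bound x₀ merged (rec classCount-merged))
      where
      open HeaviestCrossEdge h
      K = maxClique u v adj
      heavy : ∀ x y → lookup K x ≡ true → lookup K y ≡ true → ρ x ≢ ρ y → inv (count (lookup K)) ≤ w₂ x y
      heavy x y x∈K y∈K ρx≢ρy = begin
        inv (count (lookup K))   ≡⟨ cong inv (trans (sym (∣maxClique∣ u v adj)) (∣∣≡count K)) ⟨
        inv (cl u v adj)         ≤⟨ inv-antimono (ℕ.<-≤-trans (s≤s z≤n) (2≤cl x y b)) (heaviest x y b ρx≢ρy) ⟩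
        inv (cl x y b)           ≡⟨ w₂-adj b ⟨
        w₂ x y                   ∎
        where
        open ℚ.≤-Reasoning
        b : Adj G x y
        b = maxClique-isClique u v adj x y (lookup⇒[]= x K x∈K) (lookup⇒[]= y K y∈K) (ρx≢ρy ∘ cong ρ)
      open Merge w₂ w₂-nonneg ρ (lookup K) ([]=⇒lookup (∈maxCliqueˡ u v adj)) ([]=⇒lookup (∈maxCliqueʳ u v adj))
        cross heavy

    n≤c+edgeSum₂+edgeSum₂ : Fin n → ι n ≤ ι c + (edgeSum G W₂ + edgeSum G W₂)
    n≤c+edgeSum₂+edgeSum₂ x₀ = begin
      ι n                                   ≡⟨ classTerm-id {n} ⟨
      classTerm singletons                  ≤⟨ classTerm≤potential w₂-nonneg singletons ⟩
      potential w₂ singletons               ≤⟨ potential≤bound x₀ singletons (<-wellFounded (classCount singletons)) ⟩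
      bound                                 ≡⟨ cong (_+_ (ι c)) (∑∑adjWeight≡edgeSum+edgeSum G W₂ W₂-sym) ⟩
      ι c + (edgeSum G W₂ + edgeSum G W₂)   ∎
      where
      open ℚ.≤-Reasoning
      singletons : Fin n → Fin n
      singletons = id
      W₂-sym : ∀ x y a b → W₂ x y a ≡ W₂ y x b
      W₂-sym x y a b = cong inv (cl-sym x y a b)

theorem1p5 : (n : ℕ) → n ≥ 2 → (G : Graph n) → NoIsolated G →
    (cl : (i j : Fin n) → Adj G i j → ℕ) →
    ((i j : Fin n) (a : Adj G i j) → IsCl G i j (cl i j a)) →
    (c : ℕ) → HasComponents G c →
    (+ n / 2 ℚ.≤ edgeSum G (λ i j a → inv (cl i j a ∸ 1)))
    × ((+ n ℤ.- + c) / 2 ℚ.≤ edgeSum G (λ i j a → inv (cl i j a)))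
theorem1p5 (suc n) _ G noIsolated cl isCl c (f , _ , f≡⇔connected) =
    half-≤ (+ suc n) (n≤edgeSum₁+edgeSum₁ noIsolated)
  , sub-half-≤ (suc n) c (n≤c+edgeSum₂+edgeSum₂ f (λ x y → Equivalence.to (f≡⇔connected x y)) zero)
  where open Cliques G cl isCl
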